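{- Let $G(A\sqcup B,E)$ be a bipartite graph and let $A=A_L\sqcup A_R$ be a partition of $A$, with $A_L$, $A_R$, $B$ nonempty. Let $G_L=G[A_L\sqcup B]$ and $G_R=G[A_R\sqcup B]$ be the induced subgraphs. Then $\psi(G)\le\psi(G_L)+\psi(G_R)$.
   Context: For a graph $G$ and a nonempty set of nodes $S$, $\mathrm{avgdeg}(G,S)=\frac{1}{|S|}\sum_{v\in S}\deg_G(v)$. For a bipartite graph $G(A\sqcup B,E)$ with nonempty parts $A$ and $B$, $\psi(G)=\mathrm{avgdeg}(G,A)\cdot\mathrm{avgdeg}(G,B)$. $G[S]$ denotes the subgraph induced by $S$. -}

module Defs where

open import Data.Bool using (Bool; true; false; if_then_else_; _∧_)
open import Data.Nat using (ℕ; zero; suc)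
open import Data.Fin using (Fin)
open import Data.Fin.Subset using (Subset; ∣_∣; ⊤)
open import Data.Vec using (lookup; tabulate; sum)
open import Data.Integer using (+_)
open import Data.Rational using (ℚ; 0ℚ; _/_; _*_)

BipGraph : ℕ → ℕ → Set
BipGraph a b = Fin a → Fin b → Bool

[_] : Bool → ℕ
[ true ] = 1
[ false ] = 0

-- Degree of x ∈ A in the induced subgraph G[SA ⊔ SB] (x assumed in SA):
-- number of neighbours of x lying in SB.
degA : ∀ {a b} → BipGraph a b → Subset b → Fin a → ℕ
degA G SB x = sum (tabulate λ y → [ lookup SB y ∧ G x y ])

degB : ∀ {a b} → BipGraph a b → Subset a → Fin b → ℕ
degB G SA y = sum (tabulate λ x → [ lookup SA x ∧ G x y ])

-- s / n as a rational; the case n = 0 is never used (all sets are nonempty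
-- by hypothesis), we return 0 there only to make the function total.
_÷_ : ℕ → ℕ → ℚ
s ÷ zero = 0ℚ
s ÷ suc k = (+ s) / suc k

avgdegA : ∀ {a b} → BipGraph a b → Subset a → Subset b → ℚ
avgdegA G SA SB = sum (tabulate λ x → [ lookup SA x ] Data.Nat.* degA G SB x) ÷ ∣ SA ∣

avgdegB : ∀ {a b} → BipGraph a b → Subset a → Subset b → ℚ
avgdegB G SA SB = sum (tabulate λ y → [ lookup SB y ] Data.Nat.* degB G SA y) ÷ ∣ SB ∣

ψ[_] : ∀ {a b} → BipGraph a b → Subset a → Subset b → ℚ
ψ[ G ] SA SB = avgdegA G SA SB * avgdegB G SA SB

ψ : ∀ {a b} → BipGraph a b → ℚ
ψ G = ψ[ G ] ⊤ ⊤

-- With X and Y the numbers of edges leaving A_L and A_R, p = |A_L|, q = |A_R| and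
-- n = |B|, every edge meets A exactly once and B exactly once, so ψ(G) = (X + Y)²/((p + q)n),
-- ψ(G_L) = X²/(pn) and ψ(G_R) = Y²/(qn). The claim is therefore the Engel form of the
-- Cauchy–Schwarz inequality (Sedrakyan's lemma) (X + Y)²/(u + v) ≤ X²/u + Y²/v for the
-- denominators u = pn and v = qn; clearing denominators, it is 2(vX)(uY) ≤ (vX)² + (uY)².
module Submission where

open import Defs
open import Data.Bool.Base using (true; false; not; _∧_)
open import Data.Fin.Base using (Fin; zero; suc)
open import Data.Fin.Subset using (Subset; ∁; ⊤; Nonempty; ∣_∣; ⁅_⁆; _∈_; _⊆_)
open import Data.Fin.Subset.Properties
  using (∣⊤∣≡n; ∣∁p∣≡n∸∣p∣; ∣p∣≤n; p⊆q⇒∣p∣≤∣q∣; ∣⁅x⁆∣≡1; x∈⁅y⁆⇒x≡y)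
import Data.Integer.Base as ℤ
open import Data.Integer.Properties using (pos-+; pos-*)
open import Data.List.Base using (_∷_; [])
open import Data.Nat.Base as ℕ using (ℕ; zero; suc; _<_)
import Data.Nat.Properties as ℕ
open import Algebra.Properties.Semiring.Sum ℕ.+-*-semiring
  using (sum-syntax; sum-cong-≗; ∑-comm; ∑-distrib-+; *-distribˡ-sum)
open import Data.Nat.Tactic.RingSolver using (solve)
open import Data.Product.Base using (_,_)
open import Data.Rational.Base as ℚ using (toℚᵘ)
import Data.Rational.Properties as ℚ
open import Data.Rational.Unnormalised.Base as ℚᵘ using (_/_; _≃_; *≤*)
import Data.Rational.Unnormalised.Properties as ℚᵘ
open import Data.Sum.Base using (inj₁; inj₂)
open import Data.Vec.Base as Vec using (tabulate; lookup)
open import Data.Vec.Properties using (lookup-replicate; lookup-map)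
open import Function.Base using (_∘_)
open import Relation.Binary.PropositionalEquality.Core using (_≡_; refl; sym; trans; cong; cong₂; subst; subst₂)
open import Relation.Binary.PropositionalEquality.Properties using (module ≡-Reasoning)

module _ where
  open import Data.Nat.Base using (_+_; _*_; _≤_)
  open ℕ.≤-Reasoning

  m≤n⇒2*m*n≤m*m+n*n : ∀ {m n} → m ≤ n → 2 * (m * n) ≤ m * m + n * n
  m≤n⇒2*m*n≤m*m+n*n {m} m≤n with ℕ.m≤n⇒∃[o]m+o≡n m≤n
  ... | d , refl = begin
    2 * (m * (m + d))          ≤⟨ ℕ.m≤m+n (2 * (m * (m + d))) (d * d) ⟩
    2 * (m * (m + d)) + d * d  ≡⟨ solve (m ∷ d ∷ []) ⟩
    m * m + (m + d) * (m + d)  ∎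

  2*m*n≤m*m+n*n : ∀ m n → 2 * (m * n) ≤ m * m + n * n
  2*m*n≤m*m+n*n m n with ℕ.≤-total m n
  ... | inj₁ m≤n = m≤n⇒2*m*n≤m*m+n*n m≤n
  ... | inj₂ n≤m = subst₂ _≤_ (cong (2 *_) (ℕ.*-comm n m)) (ℕ.+-comm (n * n) (m * m))
                     (m≤n⇒2*m*n≤m*m+n*n n≤m)

  sedrakyan : ∀ x y u v → (x + y) * (x + y) * (u * v) ≤ (x * x * v + y * y * u) * (u + v)
  sedrakyan x y u v = begin
    (x + y) * (x + y) * (u * v)
      ≡⟨ solve (x ∷ y ∷ u ∷ v ∷ []) ⟩
    x * x * (u * v) + y * y * (u * v) + 2 * ((v * x) * (u * y))
      ≤⟨ ℕ.+-monoʳ-≤ (x * x * (u * v) + y * y * (u * v)) (2*m*n≤m*m+n*n (v * x) (u * y)) ⟩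
    x * x * (u * v) + y * y * (u * v) + ((v * x) * (v * x) + (u * y) * (u * y))
      ≡⟨ solve (x ∷ y ∷ u ∷ v ∷ []) ⟩
    (x * x * v + y * y * u) * (u + v) ∎

module _ where
  open ℤ using (+_; +≤+)
  open import Data.Rational.Unnormalised.Base using (_*_; _+_; _≤_)

  /-*-/ : ∀ a b {i j} → (+ a / suc i) * (+ b / suc j) ≡ + (a ℕ.* b) / (suc i ℕ.* suc j)
  /-*-/ a b {i} {j} = cong (λ z → z / (suc i ℕ.* suc j)) (sym (pos-* a b))

  /-+-/ : ∀ a b {i j} →
          (+ a / suc i) + (+ b / suc j) ≡ + (a ℕ.* suc j ℕ.+ b ℕ.* suc i) / (suc i ℕ.* suc j)
  /-+-/ a b {i} {j} = cong (λ z → z / (suc i ℕ.* suc j)) (begin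
    + a ℤ.* + suc j ℤ.+ + b ℤ.* + suc i
      ≡⟨ cong₂ ℤ._+_ (sym (pos-* a (suc j))) (sym (pos-* b (suc i))) ⟩
    + (a ℕ.* suc j) ℤ.+ + (b ℕ.* suc i)
      ≡⟨ sym (pos-+ (a ℕ.* suc j) (b ℕ.* suc i)) ⟩
    + (a ℕ.* suc j ℕ.+ b ℕ.* suc i) ∎)
    where open ≡-Reasoning

  /-mono-≤ : ∀ {a b i j} → a ℕ.* suc j ℕ.≤ b ℕ.* suc i → + a / suc i ≤ + b / suc j
  /-mono-≤ {a} {b} {i} {j} h = *≤* (subst₂ ℤ._≤_ (pos-* a (suc j)) (pos-* b (suc i)) (+≤+ h))

  toℚᵘ-÷ : ∀ s k → toℚᵘ (s ÷ suc k) ≃ + s / suc k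
  toℚᵘ-÷ s k = ℚ.toℚᵘ-fromℚᵘ (+ s / suc k)

  toℚᵘ-÷*÷ : ∀ a b i j → toℚᵘ ((a ÷ suc i) ℚ.* (b ÷ suc j)) ≃ + (a ℕ.* b) / (suc i ℕ.* suc j)
  toℚᵘ-÷*÷ a b i j = begin
    toℚᵘ ((a ÷ suc i) ℚ.* (b ÷ suc j))          ≈⟨ ℚ.toℚᵘ-homo-* (a ÷ suc i) (b ÷ suc j) ⟩
    toℚᵘ (a ÷ suc i) * toℚᵘ (b ÷ suc j)         ≈⟨ ℚᵘ.*-cong (toℚᵘ-÷ a i) (toℚᵘ-÷ b j) ⟩
    (+ a / suc i) * (+ b / suc j)               ≡⟨ /-*-/ a b {i} {j} ⟩
    + (a ℕ.* b) / (suc i ℕ.* suc j)             ∎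
    where open ℚᵘ.≃-Reasoning

  sedrakyan-÷ : ∀ x y {p q n} → 0 < p → 0 < q → 0 < n →
                ((x ℕ.+ y) ÷ (p ℕ.+ q)) ℚ.* ((x ℕ.+ y) ÷ n)
                  ℚ.≤ (x ÷ p) ℚ.* (x ÷ n) ℚ.+ (y ÷ q) ℚ.* (y ÷ n)
  sedrakyan-÷ x y {suc p} {suc q} {suc n} _ _ _ = ℚ.toℚᵘ-cancel-≤ (begin
    toℚᵘ ((s ÷ (P ℕ.+ Q)) ℚ.* (s ÷ N))
      ≃⟨ toℚᵘ-÷*÷ s s (p ℕ.+ Q) n ⟩
    + (s ℕ.* s) / ((P ℕ.+ Q) ℕ.* N)
      ≤⟨ /-mono-≤ cross-multiplied ⟩
    + num / (P ℕ.* N ℕ.* (Q ℕ.* N))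
      ≡⟨ /-+-/ (x ℕ.* x) (y ℕ.* y) ⟨
    (+ (x ℕ.* x) / (P ℕ.* N)) + (+ (y ℕ.* y) / (Q ℕ.* N))
      ≃⟨ ℚᵘ.+-cong (toℚᵘ-÷*÷ x x p n) (toℚᵘ-÷*÷ y y q n) ⟨
    toℚᵘ ((x ÷ P) ℚ.* (x ÷ N)) + toℚᵘ ((y ÷ Q) ℚ.* (y ÷ N))
      ≃⟨ ℚ.toℚᵘ-homo-+ ((x ÷ P) ℚ.* (x ÷ N)) ((y ÷ Q) ℚ.* (y ÷ N)) ⟨
    toℚᵘ ((x ÷ P) ℚ.* (x ÷ N) ℚ.+ (y ÷ Q) ℚ.* (y ÷ N)) ∎)
    where
    open ℚᵘ.≤-Reasoning
    P Q N s num : ℕ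
    P = suc p
    Q = suc q
    N = suc n
    s = x ℕ.+ y
    num = x ℕ.* x ℕ.* (Q ℕ.* N) ℕ.+ y ℕ.* y ℕ.* (P ℕ.* N)
    cross-multiplied : s ℕ.* s ℕ.* (P ℕ.* N ℕ.* (Q ℕ.* N)) ℕ.≤ num ℕ.* ((P ℕ.+ Q) ℕ.* N)
    cross-multiplied = ℕ.≤-trans (sedrakyan x y (P ℕ.* N) (Q ℕ.* N))
                         (ℕ.≤-reflexive (cong (num ℕ.*_) (sym (ℕ.*-distribʳ-+ N P Q))))

module _ where
  open import Data.Nat.Base using (_+_; _*_)
  open ≡-Reasoning

  sum-tabulate : ∀ {n} (f : Fin n → ℕ) → Vec.sum (tabulate f) ≡ ∑[ i < n ] f i
  sum-tabulate {zero}  f = refl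
  sum-tabulate {suc n} f = cong (f zero +_) (sum-tabulate (f ∘ suc))

  [c]*[d]≡[c∧d] : ∀ c d → [ c ] * [ d ] ≡ [ c ∧ d ]
  [c]*[d]≡[c∧d] true  true  = refl
  [c]*[d]≡[c∧d] true  false = refl
  [c]*[d]≡[c∧d] false _     = refl

  [d]≡[c∧d]+[¬c∧d] : ∀ c d → [ d ] ≡ [ c ∧ d ] + [ not c ∧ d ]
  [d]≡[c∧d]+[¬c∧d] true  true  = refl
  [d]≡[c∧d]+[¬c∧d] true  false = refl
  [d]≡[c∧d]+[¬c∧d] false true  = refl
  [d]≡[c∧d]+[¬c∧d] false false = refl

  edges : ∀ {a b} → BipGraph a b → Subset a → ℕ
  edges {a} {b} G S = ∑[ x < a ] ∑[ y < b ] [ lookup S x ∧ G x y ]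

  module _ {a b} (G : BipGraph a b) where

    degA-⊤ : ∀ x → degA G ⊤ x ≡ ∑[ y < b ] [ G x y ]
    degA-⊤ x = trans (sum-tabulate (λ y → [ lookup ⊤ y ∧ G x y ]))
      (sum-cong-≗ λ y → cong (λ c → [ c ∧ G x y ]) (lookup-replicate y true))

    ∑-degA≡edges : ∀ S → Vec.sum (tabulate λ x → [ lookup S x ] * degA G ⊤ x) ≡ edges G S
    ∑-degA≡edges S = begin
      Vec.sum (tabulate λ x → [ lookup S x ] * degA G ⊤ x)
        ≡⟨ sum-tabulate (λ x → [ lookup S x ] * degA G ⊤ x) ⟩
      ∑[ x < a ] ([ lookup S x ] * degA G ⊤ x)
        ≡⟨ sum-cong-≗ (λ x → cong ([ lookup S x ] *_) (degA-⊤ x)) ⟩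
      ∑[ x < a ] ([ lookup S x ] * ∑[ y < b ] [ G x y ])
        ≡⟨ sum-cong-≗ (λ x → *-distribˡ-sum [ lookup S x ] (λ y → [ G x y ])) ⟩
      ∑[ x < a ] ∑[ y < b ] ([ lookup S x ] * [ G x y ])
        ≡⟨ sum-cong-≗ (λ x → sum-cong-≗ λ y → [c]*[d]≡[c∧d] (lookup S x) (G x y)) ⟩
      edges G S ∎

    ∑-degB≡edges : ∀ S → Vec.sum (tabulate λ y → [ lookup ⊤ y ] * degB G S y) ≡ edges G S
    ∑-degB≡edges S = begin
      Vec.sum (tabulate λ y → [ lookup ⊤ y ] * degB G S y)
        ≡⟨ sum-tabulate (λ y → [ lookup ⊤ y ] * degB G S y) ⟩
      ∑[ y < b ] ([ lookup ⊤ y ] * degB G S y)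
        ≡⟨ sum-cong-≗ (λ y → trans (cong (λ c → [ c ] * degB G S y) (lookup-replicate y true))
                                   (trans (ℕ.*-identityˡ (degB G S y))
                                          (sum-tabulate (λ x → [ lookup S x ∧ G x y ])))) ⟩
      ∑[ y < b ] ∑[ x < a ] [ lookup S x ∧ G x y ]
        ≡⟨ ∑-comm (λ x y → [ lookup S x ∧ G x y ]) ⟨
      edges G S ∎

    ψ[]-edges : ∀ S → ψ[ G ] S ⊤ ≡ (edges G S ÷ ∣ S ∣) ℚ.* (edges G S ÷ b)
    ψ[]-edges S = cong₂ ℚ._*_ (cong (_÷ ∣ S ∣) (∑-degA≡edges S))
                               (cong₂ _÷_ (∑-degB≡edges S) (∣⊤∣≡n b))

    edges-split-∁ : ∀ S → edges G ⊤ ≡ edges G S + edges G (∁ S)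
    edges-split-∁ S = begin
      ∑[ x < a ] ∑[ y < b ] [ lookup ⊤ x ∧ G x y ]
        ≡⟨ sum-cong-≗ (λ x → sum-cong-≗ λ y → split x y) ⟩
      ∑[ x < a ] ∑[ y < b ] ([ lookup S x ∧ G x y ] + [ lookup (∁ S) x ∧ G x y ])
        ≡⟨ sum-cong-≗ (λ x → ∑-distrib-+ (λ y → [ lookup S x ∧ G x y ])
                                          (λ y → [ lookup (∁ S) x ∧ G x y ])) ⟩
      ∑[ x < a ] (∑[ y < b ] [ lookup S x ∧ G x y ] + ∑[ y < b ] [ lookup (∁ S) x ∧ G x y ])
        ≡⟨ ∑-distrib-+ (λ x → ∑[ y < b ] [ lookup S x ∧ G x y ])
                       (λ x → ∑[ y < b ] [ lookup (∁ S) x ∧ G x y ]) ⟩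
      edges G S + edges G (∁ S) ∎
      where
      split : ∀ x y → [ lookup ⊤ x ∧ G x y ] ≡ [ lookup S x ∧ G x y ] + [ lookup (∁ S) x ∧ G x y ]
      split x y rewrite lookup-replicate x true | lookup-map x not S =
        [d]≡[c∧d]+[¬c∧d] (lookup S x) (G x y)

  ∣p∣+∣∁p∣≡n : ∀ {n} (p : Subset n) → ∣ p ∣ + ∣ ∁ p ∣ ≡ n
  ∣p∣+∣∁p∣≡n p = trans (cong (∣ p ∣ +_) (∣∁p∣≡n∸∣p∣ p)) (ℕ.m+[n∸m]≡n (∣p∣≤n p))

  nonempty⇒∣p∣>0 : ∀ {n} {p : Subset n} → Nonempty p → 0 < ∣ p ∣
  nonempty⇒∣p∣>0 {p = p} (x , x∈p) = subst (ℕ._≤ ∣ p ∣) (∣⁅x⁆∣≡1 x) (p⊆q⇒∣p∣≤∣q∣ ⁅x⁆⊆p)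
    where
    ⁅x⁆⊆p : ⁅ x ⁆ ⊆ p
    ⁅x⁆⊆p y∈⁅x⁆ = subst (_∈ p) (sym (x∈⁅y⁆⇒x≡y x y∈⁅x⁆)) x∈p

open import Data.Rational using (_≤_; _+_)

lemma4 : ∀ {a b : ℕ} (G : BipGraph a b) (AL : Subset a) →
         Nonempty AL → Nonempty (∁ AL) → 0 < b →
         ψ G ≤ ψ[ G ] AL ⊤ + ψ[ G ] (∁ AL) ⊤
lemma4 {a} {b} G AL neL neR b>0 = begin
  ψ G
    ≡⟨ ψ[]-edges G ⊤ ⟩
  (edges G ⊤ ÷ ∣ ⊤ {a} ∣) ℚ.* (edges G ⊤ ÷ b)
    ≡⟨ cong₂ (λ e k → (e ÷ k) ℚ.* (e ÷ b))
             (edges-split-∁ G AL) (trans (∣⊤∣≡n a) (sym (∣p∣+∣∁p∣≡n AL))) ⟩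
  ((X ℕ.+ Y) ÷ (∣ AL ∣ ℕ.+ ∣ ∁ AL ∣)) ℚ.* ((X ℕ.+ Y) ÷ b)
    ≤⟨ sedrakyan-÷ X Y (nonempty⇒∣p∣>0 neL) (nonempty⇒∣p∣>0 neR) b>0 ⟩
  (X ÷ ∣ AL ∣) ℚ.* (X ÷ b) + (Y ÷ ∣ ∁ AL ∣) ℚ.* (Y ÷ b)
    ≡⟨ cong₂ _+_ (ψ[]-edges G AL) (ψ[]-edges G (∁ AL)) ⟨
  ψ[ G ] AL ⊤ + ψ[ G ] (∁ AL) ⊤ ∎
  where
  open ℚ.≤-Reasoning
  X Y : ℕ
  X = edges G AL
  Y = edges G (∁ AL)
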